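{- The minimal typing algorithm of System $\mathsf{F}_{<:}^{K\top}$ terminates on every $\mathsf{F}_{<:}^{\top}$-term $\Theta\vdash^\top t$.
   Context: System $\mathsf{F}_{<:}^{K\top}$. Raw types: $T ::= \top \mid X \mid T\to T \mid \forall^{K}(X<:T).T \mid \forall^{\top}(X<:T).T$ (up to $\alpha$-conversion). Raw terms: $t ::= \mathsf{top}\mid x\mid \lambda(x:T).t\mid \Lambda(X<:T).t\mid t\,t\mid t\{T\}$. Contexts $\Theta$ are finite sequences of $X<:T$ and $x:T$ with usual well-formedness. Algorithmic subtyping $\Theta\vdash_A S<:T$ is generated by: $\Theta\vdash_A T<:\top$; $\Theta\vdash_A X<:X$; if $\Theta=\Theta_1,X<:S,\Theta_2$ and $\Theta\vdash_A S<:T$ with $T\not\equiv\top,X$ then $\Theta\vdash_A X<:T$; from $\Theta\vdash_A S'<:S$, $\Theta\vdash_A T<:T'$ infer $\Theta\vdash_A S\to T<:S'\to T'$; from $\Theta,X<:S\vdash_A T<:T'$ infer $\Theta\vdash_A\forall^K(X<:S).T<:\forall^K(X<:S).T'$; from $\Theta\vdash_A T_0<:S_0$, $\Theta,X<:S_0\vdash_A S_1<:T_1$ infer $\Theta\vdash_A\forall^K(X<:S_0).S_1<:\forall^\top(X<:T_0).T_1$; from $\Theta\vdash_A T_0<:S_0$, $\Theta,X<:\top\vdash_A S_1<:T_1$ infer $\Theta\vdash_A\forall^\top(X<:S_0).S_1<:\forall^\top(X<:T_0).T_1$. The subtyping algorithm, on input $\Theta\vdash_A S<:T$, searches bottom-up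 for a derivation: at most one rule has a matching conclusion; it recursively runs on that rule's premises, accepting if all are accepted and rejecting if no rule applies or a premise is rejected (it need not terminate in general). Define $\Theta^*(T)=\Theta^*(S)$ if $T$ is a variable $X$ with $\Theta=\Theta',X<:S,\Theta''$, and $\Theta^*(T)=T$ otherwise. Minimal typing judgments $\Theta\vdash_M t:T$: $\Theta,x:T,\Theta'\vdash_M x:T$; $\Theta\vdash_M\mathsf{top}:\top$; $\Theta\vdash_M\lambda(x:S).t:S\to T$ from $\Theta,x:S\vdash_M t:T$; $\Theta\vdash_M r\,s:T$ from $\Theta\vdash_M r:R$, $\Theta\vdash_M s:S$, $\Theta\vdash S<:S'$ where $\Theta^*(R)=S'\to T$; $\Theta\vdash_M\Lambda(X<:S).t:\forall^K(X<:S).T$ from $\Theta,X<:S\vdash_M t:T$; $\Theta\vdash_M r\{S\}:T[S/X]$ from $\Theta\vdash_M r:R$ and $\Theta\vdash S<:S'$ where $\Theta^*(R)$ is $\forall^K(X<:S').T$ or $\forall^\top(X<:S').T$. The minimal typing algorithm computes, by structural recursion on $t$ following these rules (each term matches the conclusion of exactly one rule), a type $T$ with $\Theta\vdash_M t:T$ or rejects; each subtyping side condition $\Theta\vdash S<:S'$ is checked by running the subtyping algorithm on $\Theta\vdash_A S<:S'$. An $\mathsf{F}_{<:}^{\top}$-type is a type with no $\forall^K$; an $\mathsf{F}_{<:}^{\top}$-term $\Theta\vdash^\top t$ is a well-formed context and term whose type annotations (in $\Theta$ and $t$) are all $\mathsf{F}_{<:}^{\top}$-types. -}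

module Defs where

-- System F<:^{K⊤} with de Bruijn indices (α-conversion is thus built in).
-- Type variables and term variables are indexed separately:
--   * a type `var X` refers to the X-th type-variable binding (X <: T),
--     counting from the most recent, ignoring term bindings;
--   * a term `var x` refers to the x-th term-variable binding (x : T),
--     counting from the most recent, ignoring type bindings.

open import Data.Nat using (ℕ; zero; suc; _<_; _≡ᵇ_)
open import Data.Bool using (Bool; true; false; _∧_; if_then_else_)
open import Data.Unit using (⊤; tt)
open import Data.Empty using (⊥)
open import Data.Product using (_×_)
open import Data.Maybe using (Maybe; just; nothing)
open import Data.List using (List; []; _∷_)

data Ty : Set where
  top  : Ty
  var  : ℕ → Ty
  _⇒_  : Ty → Ty → Ty
  allK : Ty → Ty → Ty
  allT : Ty → Ty → Ty

infixr 7 _⇒_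

data Tm : Set where
  top  : Tm
  var  : ℕ → Tm
  lam  : Ty → Tm → Tm
  Lam  : Ty → Tm → Tm
  app  : Tm → Tm → Tm
  tapp : Tm → Ty → Tm

-- Context entries; a context is a list with the MOST RECENT entry first.
-- The type stored in an entry is scoped over the type variables of the
-- part of the context after it (i.e. older entries).
data Entry : Set where
  tvar  : Ty → Entry
  tmvar : Ty → Entry

Ctx : Set
Ctx = List Entry

ext : (ℕ → ℕ) → ℕ → ℕ
ext ρ zero    = zero
ext ρ (suc n) = suc (ρ n)

rename : (ℕ → ℕ) → Ty → Ty
rename ρ top        = top
rename ρ (var X)    = var (ρ X)
rename ρ (S ⇒ T)    = rename ρ S ⇒ rename ρ T
rename ρ (allK S T) = allK (rename ρ S) (rename (ext ρ) T)
rename ρ (allT S T) = allT (rename ρ S) (rename (ext ρ) T)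

wk : Ty → Ty
wk = rename suc

exts : (ℕ → Ty) → ℕ → Ty
exts σ zero    = var zero
exts σ (suc n) = wk (σ n)

subst : (ℕ → Ty) → Ty → Ty
subst σ top        = top
subst σ (var X)    = σ X
subst σ (S ⇒ T)    = subst σ S ⇒ subst σ T
subst σ (allK S T) = allK (subst σ S) (subst (exts σ) T)
subst σ (allT S T) = allT (subst σ S) (subst (exts σ) T)

subst0 : Ty → Ty → Ty
subst0 S T = subst σ T
  where
  σ : ℕ → Ty
  σ zero    = S
  σ (suc n) = var n

-- syntactic equality of types (= α-equivalence, with de Bruijn indices)
eqTy : Ty → Ty → Bool
eqTy top top = true
eqTy (var X) (var Y) = X ≡ᵇ Y
eqTy (S ⇒ T) (S' ⇒ T') = eqTy S S' ∧ eqTy T T'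
eqTy (allK S T) (allK S' T') = eqTy S S' ∧ eqTy T T'
eqTy (allT S T) (allT S' T') = eqTy S S' ∧ eqTy T T'
eqTy _ _ = false

-- bound of type variable X, as a type in the whole context
lookupTv : Ctx → ℕ → Maybe Ty
lookupTv [] X = nothing
lookupTv (tmvar _ ∷ Γ) X = lookupTv Γ X
lookupTv (tvar B ∷ Γ) zero = just (wk B)
lookupTv (tvar B ∷ Γ) (suc X) with lookupTv Γ X
... | just T  = just (wk T)
... | nothing = nothing

-- type of term variable x, as a type in the whole context
lookupTm : Ctx → ℕ → Maybe Ty
lookupTm [] x = nothing
lookupTm (tmvar T ∷ Γ) zero = just T
lookupTm (tmvar T ∷ Γ) (suc x) = lookupTm Γ x
lookupTm (tvar _ ∷ Γ) x with lookupTm Γ x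
... | just T  = just (wk T)
... | nothing = nothing

-- Θ*(T): repeated replacement of a variable by its bound.
-- (nothing only when a variable is unbound, impossible in well-formed contexts)
mutual
  star : Ctx → Ty → Maybe Ty
  star Γ (var X) = starVar Γ X
  star Γ T       = just T

  starVar : Ctx → ℕ → Maybe Ty
  starVar [] X = nothing
  starVar (tmvar _ ∷ Γ) X = starVar Γ X
  starVar (tvar B ∷ Γ) zero with star Γ B
  ... | just T  = just (wk T)
  ... | nothing = nothing
  starVar (tvar B ∷ Γ) (suc X) with starVar Γ X
  ... | just T  = just (wk T)
  ... | nothing = nothing

-- Algorithms, run with a fuel bound (recursion depth).
-- `timeout` means the fuel ran out; the algorithm terminates on an input
-- iff some amount of fuel yields a non-`timeout` outcome.

data Outcome (A : Set) : Set where
  timeout : Outcome A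
  reject  : Outcome A
  accept  : A → Outcome A

_>>=_ : {A B : Set} → Outcome A → (A → Outcome B) → Outcome B
timeout  >>= k = timeout
reject   >>= k = reject
accept a >>= k = k a

_>>_ : {B : Set} → Outcome ⊤ → Outcome B → Outcome B
o >> o' = o >>= λ _ → o'

fromMaybe : {A : Set} → Maybe A → Outcome A
fromMaybe (just a) = accept a
fromMaybe nothing  = reject

-- The subtyping algorithm for Θ ⊢_A S <: T (premises run left to right).
sub : ℕ → Ctx → Ty → Ty → Outcome ⊤
sub zero    Γ S T = timeout
sub (suc n) Γ S top = accept tt
sub (suc n) Γ (var X) (var Y) =
  if X ≡ᵇ Y then accept tt
  else (fromMaybe (lookupTv Γ X) >>= λ B → sub n Γ B (var Y))
sub (suc n) Γ (var X) T =
  fromMaybe (lookupTv Γ X) >>= λ B → sub n Γ B T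
sub (suc n) Γ (S ⇒ T) (S' ⇒ T') = sub n Γ S' S >> sub n Γ T T'
sub (suc n) Γ (allK S T) (allK S' T') =
  if eqTy S S' then sub n (tvar S ∷ Γ) T T' else reject
sub (suc n) Γ (allK S₀ S₁) (allT T₀ T₁) =
  sub n Γ T₀ S₀ >> sub n (tvar S₀ ∷ Γ) S₁ T₁
sub (suc n) Γ (allT S₀ S₁) (allT T₀ T₁) =
  sub n Γ T₀ S₀ >> sub n (tvar top ∷ Γ) S₁ T₁
sub (suc n) Γ S T = reject

-- The minimal typing algorithm (structural in the term; every subtyping
-- side condition is run with the subtyping algorithm using fuel n).
typ : ℕ → Ctx → Tm → Outcome Ty
typ n Γ (var x) = fromMaybe (lookupTm Γ x)
typ n Γ top = accept top
typ n Γ (lam S t) = typ n (tmvar S ∷ Γ) t >>= λ T → accept (S ⇒ T)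
typ n Γ (Lam S t) = typ n (tvar S ∷ Γ) t >>= λ T → accept (allK S T)
typ n Γ (app r s) =
  typ n Γ r >>= λ R → typ n Γ s >>= λ S → appCase (star Γ R) S
  where
  appCase : Maybe Ty → Ty → Outcome Ty
  appCase (just (S' ⇒ T)) S = sub n Γ S S' >> accept T
  appCase _ S = reject
typ n Γ (tapp r S) =
  typ n Γ r >>= λ R → tappCase (star Γ R)
  where
  tappCase : Maybe Ty → Outcome Ty
  tappCase (just (allK S' T)) = sub n Γ S S' >> accept (subst0 S T)
  tappCase (just (allT S' T)) = sub n Γ S S' >> accept (subst0 S T)
  tappCase _ = reject

ntv : Ctx → ℕ
ntv [] = zero
ntv (tvar _ ∷ Γ) = suc (ntv Γ)
ntv (tmvar _ ∷ Γ) = ntv Γ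

ntm : Ctx → ℕ
ntm [] = zero
ntm (tvar _ ∷ Γ) = ntm Γ
ntm (tmvar _ ∷ Γ) = suc (ntm Γ)

WfTy : ℕ → Ty → Set
WfTy k top = ⊤
WfTy k (var X) = X < k
WfTy k (S ⇒ T) = WfTy k S × WfTy k T
WfTy k (allK S T) = WfTy k S × WfTy (suc k) T
WfTy k (allT S T) = WfTy k S × WfTy (suc k) T

WfCtx : Ctx → Set
WfCtx [] = ⊤
WfCtx (tvar T ∷ Γ) = WfCtx Γ × WfTy (ntv Γ) T
WfCtx (tmvar T ∷ Γ) = WfCtx Γ × WfTy (ntv Γ) T

WfTm : ℕ → ℕ → Tm → Set
WfTm k m top = ⊤
WfTm k m (var x) = x < m
WfTm k m (lam S t) = WfTy k S × WfTm k (suc m) t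
WfTm k m (Lam S t) = WfTy k S × WfTm (suc k) m t
WfTm k m (app r s) = WfTm k m r × WfTm k m s
WfTm k m (tapp r S) = WfTm k m r × WfTy k S

FTopTy : Ty → Set
FTopTy top = ⊤
FTopTy (var X) = ⊤
FTopTy (S ⇒ T) = FTopTy S × FTopTy T
FTopTy (allK S T) = ⊥
FTopTy (allT S T) = FTopTy S × FTopTy T

FTopCtx : Ctx → Set
FTopCtx [] = ⊤
FTopCtx (tvar T ∷ Γ) = FTopTy T × FTopCtx Γ
FTopCtx (tmvar T ∷ Γ) = FTopTy T × FTopCtx Γ

FTopAnn : Tm → Set
FTopAnn top = ⊤
FTopAnn (var x) = ⊤
FTopAnn (lam S t) = FTopTy S × FTopAnn t
FTopAnn (Lam S t) = FTopTy S × FTopAnn t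
FTopAnn (app r s) = FTopAnn r × FTopAnn s
FTopAnn (tapp r S) = FTopAnn r × FTopTy S

record FTopTerm (Γ : Ctx) (t : Tm) : Set where
  field
    ctxWf   : WfCtx Γ
    tmWf    : WfTm (ntv Γ) (ntm Γ) t
    ctxFTop : FTopCtx Γ
    tmFTop  : FTopAnn t

{-# OPTIONS --safe #-}
-- Minimal typing of an F<:^⊤-term only produces types that are F<:^⊤-types except for
-- ∀^K along the result spine (each Λ contributes one), so every subtyping query it issues
-- has such a type on the left and an F<:^⊤-type on the right. The rule ∀^K <: ∀^K then never
-- fires, and subtyping terminates on these queries by a lexicographic induction on the
-- number of ∀^K on the left spine and a weight in which every type variable outweighs its
-- bound.
module Submission where

open import Defs
open import Data.Nat using (ℕ; zero; suc; _+_; _≤_; _<_; _⊔_; z≤n; s≤s; _≡ᵇ_)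
open import Data.Nat.Properties
open import Data.Product using (∃-syntax; _×_; _,_)
open import Data.Unit using (⊤; tt)
open import Data.Bool using (Bool; true; false; if_then_else_)
open import Data.Maybe using (Maybe; just; nothing)
open import Data.List using ([]; _∷_)
open import Data.Maybe.Relation.Unary.All as All using (All; just; nothing)
open import Function using (const)
open import Relation.Binary.PropositionalEquality using (_≡_; refl; _≢_; sym; trans; cong; cong₂)
open ≤-Reasoning

data Halted {A : Set} (P : A → Set) : Outcome A → Set where
  rejected : Halted P reject
  accepted : ∀ {a} → P a → Halted P (accept a)

fromMaybe-halted : ∀ {A : Set} {P : A → Set} {m : Maybe A} → All P m → Halted P (fromMaybe m)
fromMaybe-halted (just p) = accepted p
fromMaybe-halted nothing  = rejected

-- Convergence rather than mere termination, so that the fuels of subcomputations can be joined.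
record Converges {A : Set} (P : A → Set) (run : ℕ → Outcome A) : Set where
  constructor converges
  field
    limit  : Outcome A
    halted : Halted P limit
    fuel   : ℕ
    stable : ∀ {n} → fuel ≤ n → run n ≡ limit

module _ {A : Set} {P : A → Set} where

  converges⇒terminates : ∀ {run} → Converges P run → ∃[ n ] (run n ≢ timeout)
  converges⇒terminates (converges _ h n st) =
    n , λ run≡timeout → halted≢timeout h (trans (sym (st ≤-refl)) run≡timeout)
    where
    halted≢timeout : ∀ {o} → Halted P o → o ≢ timeout
    halted≢timeout rejected ()
    halted≢timeout (accepted _) ()

  converges-const : ∀ {o} → Halted P o → Converges P (const o)
  converges-const h = converges _ h 0 (λ _ → refl)

  converges-step : ∀ {run} → Converges P (λ n → run (suc n)) → Converges P run
  converges-step (converges o h n st) = converges o h (suc n) λ { (s≤s le) → st le }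

  converges-cong : ∀ {run run′} → (∀ n → run n ≡ run′ n) → Converges P run → Converges P run′
  converges-cong eq (converges o h n st) = converges o h n λ le → trans (sym (eq _)) (st le)

  converges-if : ∀ {f g} (b : Bool) → Converges P f → Converges P g →
                 Converges P (λ n → if b then f n else g n)
  converges-if true  cf cg = cf
  converges-if false cf cg = cg

  converges->>= : ∀ {B : Set} {Q : B → Set} {f : ℕ → Outcome A} {k : ℕ → A → Outcome B} →
                  Converges P f → (∀ {a} → P a → Converges Q (λ n → k n a)) →
                  Converges Q (λ n → f n >>= k n)
  converges->>= {k = k} (converges reject rejected n st) ck =
    converges reject rejected n λ {m} le → cong (_>>= k m) (st le)
  converges->>= {k = k} (converges (accept a) (accepted p) n st) ck with ck p
  ... | converges o h n′ st′ = converges o h (n ⊔ n′) λ {m} le →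
    trans (cong (_>>= k m) (st (m⊔n≤o⇒m≤o n n′ le))) (st′ (m⊔n≤o⇒n≤o n n′ le))

KSpine : Ty → Set
KSpine top        = ⊤
KSpine (var X)    = ⊤
KSpine (S ⇒ T)    = FTopTy S × KSpine T
KSpine (allK S T) = FTopTy S × KSpine T
KSpine (allT S T) = FTopTy S × KSpine T

spineK : Ty → ℕ
spineK top        = 0
spineK (var _)    = 0
spineK (S ⇒ T)    = spineK T
spineK (allK S T) = suc (spineK T)
spineK (allT S T) = spineK T

ftop⇒kspine : ∀ T → FTopTy T → KSpine T
ftop⇒kspine top        _       = tt
ftop⇒kspine (var X)    _       = tt
ftop⇒kspine (S ⇒ T)    (s , t) = s , ftop⇒kspine T t
ftop⇒kspine (allT S T) (s , t) = s , ftop⇒kspine T t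

ftop⇒spineK≤ : ∀ {k} T → FTopTy T → spineK T ≤ k
ftop⇒spineK≤ top        _       = z≤n
ftop⇒spineK≤ (var X)    _       = z≤n
ftop⇒spineK≤ (S ⇒ T)    (_ , t) = ftop⇒spineK≤ T t
ftop⇒spineK≤ (allT S T) (_ , t) = ftop⇒spineK≤ T t

ftop-rename : ∀ ρ T → FTopTy T → FTopTy (rename ρ T)
ftop-rename ρ top        _       = tt
ftop-rename ρ (var X)    _       = tt
ftop-rename ρ (S ⇒ T)    (s , t) = ftop-rename ρ S s , ftop-rename ρ T t
ftop-rename ρ (allT S T) (s , t) = ftop-rename ρ S s , ftop-rename (ext ρ) T t

ftop-exts : ∀ σ → (∀ X → FTopTy (σ X)) → ∀ X → FTopTy (exts σ X)
ftop-exts σ fσ zero    = tt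
ftop-exts σ fσ (suc X) = ftop-rename suc (σ X) (fσ X)

ftop-subst : ∀ σ T → (∀ X → FTopTy (σ X)) → FTopTy T → FTopTy (subst σ T)
ftop-subst σ top        fσ _       = tt
ftop-subst σ (var X)    fσ _       = fσ X
ftop-subst σ (S ⇒ T)    fσ (s , t) = ftop-subst σ S fσ s , ftop-subst σ T fσ t
ftop-subst σ (allT S T) fσ (s , t) = ftop-subst σ S fσ s , ftop-subst (exts σ) T (ftop-exts σ fσ) t

kspine-subst : ∀ σ T → (∀ X → FTopTy (σ X)) → KSpine T → KSpine (subst σ T)
kspine-subst σ top        fσ _       = tt
kspine-subst σ (var X)    fσ _       = ftop⇒kspine (σ X) (fσ X)
kspine-subst σ (S ⇒ T)    fσ (s , t) = ftop-subst σ S fσ s , kspine-subst σ T fσ t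
kspine-subst σ (allK S T) fσ (s , t) = ftop-subst σ S fσ s , kspine-subst (exts σ) T (ftop-exts σ fσ) t
kspine-subst σ (allT S T) fσ (s , t) = ftop-subst σ S fσ s , kspine-subst (exts σ) T (ftop-exts σ fσ) t

kspine-subst0 : ∀ S T → FTopTy S → KSpine T → KSpine (subst0 S T)
kspine-subst0 S T s t = kspine-subst _ T (λ { zero → s ; (suc X) → tt }) t

lookupTm-ftop : ∀ Γ x → FTopCtx Γ → All FTopTy (lookupTm Γ x)
lookupTm-ftop []            x       _        = nothing
lookupTm-ftop (tmvar T ∷ Γ) zero    (t , _)  = just t
lookupTm-ftop (tmvar T ∷ Γ) (suc x) (_ , fΓ) = lookupTm-ftop Γ x fΓ
lookupTm-ftop (tvar _ ∷ Γ)  x       (_ , fΓ) with lookupTm Γ x | lookupTm-ftop Γ x fΓ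
... | just T  | just t  = just (ftop-rename suc T t)
... | nothing | nothing = nothing

star-ftop    : ∀ Γ B → FTopCtx Γ → FTopTy B → All FTopTy (star Γ B)
starVar-ftop : ∀ Γ X → FTopCtx Γ → All FTopTy (starVar Γ X)

star-ftop Γ top        fΓ b = just b
star-ftop Γ (var X)    fΓ b = starVar-ftop Γ X fΓ
star-ftop Γ (S ⇒ T)    fΓ b = just b
star-ftop Γ (allT S T) fΓ b = just b

starVar-ftop []            X       _        = nothing
starVar-ftop (tmvar _ ∷ Γ) X       (_ , fΓ) = starVar-ftop Γ X fΓ
starVar-ftop (tvar B ∷ Γ)  zero    (b , fΓ) with star Γ B | star-ftop Γ B fΓ b
... | just T  | just t  = just (ftop-rename suc T t)
... | nothing | nothing = nothing
starVar-ftop (tvar B ∷ Γ)  (suc X) (_ , fΓ) with starVar Γ X | starVar-ftop Γ X fΓ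
... | just T  | just t  = just (ftop-rename suc T t)
... | nothing | nothing = nothing

star-kspine : ∀ Γ R → FTopCtx Γ → KSpine R → All KSpine (star Γ R)
star-kspine Γ top        fΓ r = just r
star-kspine Γ (var X)    fΓ r = All.map (ftop⇒kspine _) (starVar-ftop Γ X fΓ)
star-kspine Γ (S ⇒ T)    fΓ r = just r
star-kspine Γ (allK S T) fΓ r = just r
star-kspine Γ (allT S T) fΓ r = just r

extWeight : (ℕ → ℕ) → ℕ → ℕ → ℕ
extWeight ρ a zero    = a
extWeight ρ a (suc X) = ρ X

-- Both quantifiers give their variable the weight 2 of a variable bounded by ⊤, so ∀^K and
-- ∀^⊤ types weigh the same.
weight : (ℕ → ℕ) → Ty → ℕ
weight ρ top        = 1
weight ρ (var X)    = ρ X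
weight ρ (S ⇒ T)    = suc (weight ρ S + weight ρ T)
weight ρ (allK S T) = suc (weight ρ S + weight (extWeight ρ 2) T)
weight ρ (allT S T) = suc (weight ρ S + weight (extWeight ρ 2) T)

-- A type variable weighs one more than its bound, so that replacing it by its bound makes progress.
ctxWeight : Ctx → ℕ → ℕ
ctxWeight []            = const 1
ctxWeight (tmvar _ ∷ Γ) = ctxWeight Γ
ctxWeight (tvar B ∷ Γ)  = extWeight (ctxWeight Γ) (suc (weight (ctxWeight Γ) B))

extWeight-ext : ∀ {ρ σ f} a → (∀ X → ρ (f X) ≡ σ X) → ∀ X → extWeight ρ a (ext f X) ≡ extWeight σ a X
extWeight-ext a eq zero    = refl
extWeight-ext a eq (suc X) = eq X

weight-rename : ∀ {ρ σ} f T → (∀ X → ρ (f X) ≡ σ X) → weight ρ (rename f T) ≡ weight σ T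
weight-rename f top        eq = refl
weight-rename f (var X)    eq = eq X
weight-rename f (S ⇒ T)    eq = cong₂ (λ a b → suc (a + b)) (weight-rename f S eq) (weight-rename f T eq)
weight-rename f (allK S T) eq =
  cong₂ (λ a b → suc (a + b)) (weight-rename f S eq) (weight-rename (ext f) T (extWeight-ext 2 eq))
weight-rename f (allT S T) eq =
  cong₂ (λ a b → suc (a + b)) (weight-rename f S eq) (weight-rename (ext f) T (extWeight-ext 2 eq))

weight-wk : ∀ ρ a T → weight (extWeight ρ a) (wk T) ≡ weight ρ T
weight-wk ρ a T = weight-rename suc T (λ _ → refl)

BoundOf : Ctx → ℕ → Ty → Set
BoundOf Γ X B = FTopTy B × weight (ctxWeight Γ) B < ctxWeight Γ X

lookupTv-bound : ∀ Γ X → FTopCtx Γ → All (BoundOf Γ X) (lookupTv Γ X)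
lookupTv-bound []            X       _        = nothing
lookupTv-bound (tmvar _ ∷ Γ) X       (_ , fΓ) = lookupTv-bound Γ X fΓ
lookupTv-bound (tvar B ∷ Γ)  zero    (b , fΓ) =
  just (ftop-rename suc B b , s≤s (≤-reflexive (weight-wk (ctxWeight Γ) _ B)))
lookupTv-bound (tvar B ∷ Γ)  (suc X) (_ , fΓ) with lookupTv Γ X | lookupTv-bound Γ X fΓ
... | just T  | just (t , T<X) =
  just (ftop-rename suc T t , ≤-trans (s≤s (≤-reflexive (weight-wk (ctxWeight Γ) _ T))) T<X)
... | nothing | nothing = nothing

querySize : Ctx → Ty → Ty → ℕ
querySize Γ S T = weight (ctxWeight Γ) S + weight (ctxWeight Γ) T

contravariant-premise< : ∀ a b c d → c + a < suc (a + b) + suc (c + d)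
contravariant-premise< a b c d = s≤s (begin
  c + a                 ≡⟨ +-comm c a ⟩
  a + c                 ≤⟨ +-mono-≤ (m≤m+n a b) (m≤m+n c d) ⟩
  (a + b) + (c + d)     ≤⟨ +-monoʳ-≤ (a + b) (n≤1+n (c + d)) ⟩
  (a + b) + suc (c + d) ∎)

covariant-premise< : ∀ a b c d → b + d < suc (a + b) + suc (c + d)
covariant-premise< a b c d = s≤s (begin
  b + d                 ≤⟨ +-mono-≤ (m≤n+m b a) (m≤n+m d c) ⟩
  (a + b) + (c + d)     ≤⟨ +-monoʳ-≤ (a + b) (n≤1+n (c + d)) ⟩
  (a + b) + suc (c + d) ∎)

⇒-dom< : ∀ Γ A B C D → querySize Γ C A < querySize Γ (A ⇒ B) (C ⇒ D)
⇒-dom< Γ A B C D = contravariant-premise< (w A) (w B) (w C) (w D) where w = weight (ctxWeight Γ)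

⇒-cod< : ∀ Γ A B C D → querySize Γ B D < querySize Γ (A ⇒ B) (C ⇒ D)
⇒-cod< Γ A B C D = covariant-premise< (w A) (w B) (w C) (w D) where w = weight (ctxWeight Γ)

allT-bound< : ∀ Γ A B C D → querySize Γ C A < querySize Γ (allT A B) (allT C D)
allT-bound< Γ A B C D = contravariant-premise< (w Γ A) (w (tvar top ∷ Γ) B) (w Γ C) (w (tvar top ∷ Γ) D)
  where w = λ Δ → weight (ctxWeight Δ)

allT-body< : ∀ Γ A B C D → querySize (tvar top ∷ Γ) B D < querySize Γ (allT A B) (allT C D)
allT-body< Γ A B C D = covariant-premise< (w Γ A) (w (tvar top ∷ Γ) B) (w Γ C) (w (tvar top ∷ Γ) D)
  where w = λ Δ → weight (ctxWeight Δ)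

SubConverges : Ctx → Ty → Ty → Set
SubConverges Γ S T = Converges (const ⊤) (λ n → sub n Γ S T)

SubConvergesBelow : ℕ → ℕ → Set
SubConvergesBelow k m = ∀ Γ S T → FTopCtx Γ → KSpine S → FTopTy T →
                        spineK S ≤ k → querySize Γ S T < m → SubConverges Γ S T

bound-converges : ∀ {k m} → SubConvergesBelow k m → ∀ Γ X T → FTopCtx Γ → FTopTy T →
                  querySize Γ (var X) T < suc m →
                  Converges (const ⊤) (λ n → fromMaybe (lookupTv Γ X) >>= λ B → sub n Γ B T)
bound-converges ih Γ X T fΓ t size< =
  converges->>= (converges-const (fromMaybe-halted (lookupTv-bound Γ X fΓ))) λ {B} (b , B<X) →
  ih Γ B T fΓ (ftop⇒kspine B b) t (ftop⇒spineK≤ B b)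
     (<-≤-trans (+-monoˡ-< (weight (ctxWeight Γ) T) B<X) (≤-pred size<))

-- Lexicographic induction on (spineK S, querySize Γ S T): only the body premise of
-- ∀^K <: ∀^⊤, checked under the left bound rather than ⊤, may grow the size, and it consumes a ∀^K.
sub-converges : ∀ k m → SubConvergesBelow k m
sub-converges k zero    Γ S T fΓ s t k≥ ()
sub-converges k (suc m) Γ S top fΓ s t k≥ size< = converges-step (converges-const (accepted tt))
sub-converges k (suc m) Γ S (allK _ _) fΓ s () k≥ size<
sub-converges k (suc m) Γ top (var _)    fΓ s t k≥ size< = converges-step (converges-const rejected)
sub-converges k (suc m) Γ top (_ ⇒ _)    fΓ s t k≥ size< = converges-step (converges-const rejected)
sub-converges k (suc m) Γ top (allT _ _) fΓ s t k≥ size< = converges-step (converges-const rejected)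
sub-converges k (suc m) Γ (var X) (var Y) fΓ s t k≥ size< =
  converges-step (converges-if (X ≡ᵇ Y) (converges-const (accepted tt))
                                        (bound-converges (sub-converges k m) Γ X (var Y) fΓ t size<))
sub-converges k (suc m) Γ (var X) (C ⇒ D) fΓ s t k≥ size< =
  converges-step (bound-converges (sub-converges k m) Γ X (C ⇒ D) fΓ t size<)
sub-converges k (suc m) Γ (var X) (allT C D) fΓ s t k≥ size< =
  converges-step (bound-converges (sub-converges k m) Γ X (allT C D) fΓ t size<)
sub-converges k (suc m) Γ (A ⇒ B) (C ⇒ D) fΓ (a , b) (c , d) k≥ size< =
  converges-step (converges->>=
    (sub-converges k m Γ C A fΓ (ftop⇒kspine C c) a (ftop⇒spineK≤ C c)
       (<-≤-trans (⇒-dom< Γ A B C D) (≤-pred size<))) λ _ →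
    sub-converges k m Γ B D fΓ b d k≥ (<-≤-trans (⇒-cod< Γ A B C D) (≤-pred size<)))
sub-converges k (suc m) Γ (A ⇒ B) (var _)    fΓ s t k≥ size< = converges-step (converges-const rejected)
sub-converges k (suc m) Γ (A ⇒ B) (allT _ _) fΓ s t k≥ size< = converges-step (converges-const rejected)
sub-converges (suc k) (suc m) Γ (allK A B) (allT C D) fΓ (a , b) (c , d) (s≤s k≥) size< =
  converges-step (converges->>=
    (sub-converges (suc k) m Γ C A fΓ (ftop⇒kspine C c) a (ftop⇒spineK≤ C c)
       (<-≤-trans (allT-bound< Γ A B C D) (≤-pred size<))) λ _ →
    sub-converges k _ (tvar A ∷ Γ) B D (a , fΓ) b d k≥ ≤-refl)
sub-converges k (suc m) Γ (allK A B) (var _) fΓ s t k≥ size< = converges-step (converges-const rejected)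
sub-converges k (suc m) Γ (allK A B) (_ ⇒ _) fΓ s t k≥ size< = converges-step (converges-const rejected)
sub-converges k (suc m) Γ (allT A B) (allT C D) fΓ (a , b) (c , d) k≥ size< =
  converges-step (converges->>=
    (sub-converges k m Γ C A fΓ (ftop⇒kspine C c) a (ftop⇒spineK≤ C c)
       (<-≤-trans (allT-bound< Γ A B C D) (≤-pred size<))) λ _ →
    sub-converges k m (tvar top ∷ Γ) B D (tt , fΓ) b d k≥ (<-≤-trans (allT-body< Γ A B C D) (≤-pred size<)))
sub-converges k (suc m) Γ (allT A B) (var _) fΓ s t k≥ size< = converges-step (converges-const rejected)
sub-converges k (suc m) Γ (allT A B) (_ ⇒ _) fΓ s t k≥ size< = converges-step (converges-const rejected)

sub-converges-kspine : ∀ Γ S T → FTopCtx Γ → KSpine S → FTopTy T → SubConverges Γ S T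
sub-converges-kspine Γ S T fΓ s t = sub-converges (spineK S) (suc (querySize Γ S T)) Γ S T fΓ s t ≤-refl ≤-refl

applyArrow : ℕ → Ctx → Maybe Ty → Ty → Outcome Ty
applyArrow n Γ (just (S′ ⇒ T)) S = sub n Γ S S′ >> accept T
applyArrow n Γ _               S = reject

instantiateAll : ℕ → Ctx → Maybe Ty → Ty → Outcome Ty
instantiateAll n Γ (just (allK S′ T)) S = sub n Γ S S′ >> accept (subst0 S T)
instantiateAll n Γ (just (allT S′ T)) S = sub n Γ S S′ >> accept (subst0 S T)
instantiateAll n Γ _                  S = reject

typ-app : ∀ n Γ r s →
          typ n Γ (app r s) ≡ (typ n Γ r >>= λ R → typ n Γ s >>= λ S → applyArrow n Γ (star Γ R) S)
typ-app n Γ r s with typ n Γ r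
... | timeout  = refl
... | reject   = refl
... | accept R with typ n Γ s
...   | timeout  = refl
...   | reject   = refl
...   | accept S with star Γ R
...     | nothing         = refl
...     | just top        = refl
...     | just (var _)    = refl
...     | just (_ ⇒ _)    = refl
...     | just (allK _ _) = refl
...     | just (allT _ _) = refl

typ-tapp : ∀ n Γ r S → typ n Γ (tapp r S) ≡ (typ n Γ r >>= λ R → instantiateAll n Γ (star Γ R) S)
typ-tapp n Γ r S with typ n Γ r
... | timeout  = refl
... | reject   = refl
... | accept R with star Γ R
...   | nothing         = refl
...   | just top        = refl
...   | just (var _)    = refl
...   | just (_ ⇒ _)    = refl
...   | just (allK _ _) = refl
...   | just (allT _ _) = refl

applyArrow-converges : ∀ Γ {M S} → FTopCtx Γ → All KSpine M → KSpine S →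
                       Converges KSpine (λ n → applyArrow n Γ M S)
applyArrow-converges Γ {just (S′ ⇒ T)} {S} fΓ (just (s′ , t)) s =
  converges->>= (sub-converges-kspine Γ S S′ fΓ s s′) λ _ → converges-const (accepted t)
applyArrow-converges Γ {just top}        fΓ _ _ = converges-const rejected
applyArrow-converges Γ {just (var _)}    fΓ _ _ = converges-const rejected
applyArrow-converges Γ {just (allK _ _)} fΓ _ _ = converges-const rejected
applyArrow-converges Γ {just (allT _ _)} fΓ _ _ = converges-const rejected
applyArrow-converges Γ {nothing}         fΓ _ _ = converges-const rejected

instantiateAll-converges : ∀ Γ {M} S → FTopCtx Γ → All KSpine M → FTopTy S →
                           Converges KSpine (λ n → instantiateAll n Γ M S)
instantiateAll-converges Γ {just (allK S′ T)} S fΓ (just (s′ , t)) s =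
  converges->>= (sub-converges-kspine Γ S S′ fΓ (ftop⇒kspine S s) s′) λ _ →
  converges-const (accepted (kspine-subst0 S T s t))
instantiateAll-converges Γ {just (allT S′ T)} S fΓ (just (s′ , t)) s =
  converges->>= (sub-converges-kspine Γ S S′ fΓ (ftop⇒kspine S s) s′) λ _ →
  converges-const (accepted (kspine-subst0 S T s t))
instantiateAll-converges Γ {just top}     S fΓ _ _ = converges-const rejected
instantiateAll-converges Γ {just (var _)} S fΓ _ _ = converges-const rejected
instantiateAll-converges Γ {just (_ ⇒ _)} S fΓ _ _ = converges-const rejected
instantiateAll-converges Γ {nothing}      S fΓ _ _ = converges-const rejected

typ-converges : ∀ Γ t → FTopCtx Γ → FTopAnn t → Converges KSpine (λ n → typ n Γ t)
typ-converges Γ top       fΓ _ = converges-const (accepted tt)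
typ-converges Γ (var x)   fΓ _ =
  converges-const (fromMaybe-halted (All.map (ftop⇒kspine _) (lookupTm-ftop Γ x fΓ)))
typ-converges Γ (lam S t) fΓ (s , ft) =
  converges->>= (typ-converges (tmvar S ∷ Γ) t (s , fΓ) ft) λ t′ → converges-const (accepted (s , t′))
typ-converges Γ (Lam S t) fΓ (s , ft) =
  converges->>= (typ-converges (tvar S ∷ Γ) t (s , fΓ) ft) λ t′ → converges-const (accepted (s , t′))
typ-converges Γ (app r s) fΓ (fr , fs) =
  converges-cong (λ n → sym (typ-app n Γ r s))
    (converges->>= (typ-converges Γ r fΓ fr) λ {R} r′ →
     converges->>= (typ-converges Γ s fΓ fs) λ s′ →
     applyArrow-converges Γ fΓ (star-kspine Γ R fΓ r′) s′)
typ-converges Γ (tapp r S) fΓ (fr , s) =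
  converges-cong (λ n → sym (typ-tapp n Γ r S))
    (converges->>= (typ-converges Γ r fΓ fr) λ {R} r′ →
     instantiateAll-converges Γ S fΓ (star-kspine Γ R fΓ r′) s)

mainTheorem9 : (Γ : Ctx) (t : Tm) → FTopTerm Γ t →
    ∃[ n ] (typ n Γ t ≢ timeout)
mainTheorem9 Γ t ft = converges⇒terminates (typ-converges Γ t (FTopTerm.ctxFTop ft) (FTopTerm.tmFTop ft))
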